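{- Let $A$ and $B$ be strings of lengths $n$ and $m$ with $m \le n$, over an alphabet together with the wildcard symbol $\mathsf{?}$, and let $k$ be the total number of wildcards occurring in $A$ and $B$ together. Let $d$ be an integer with $1 \le d < k$ and $d < m$ such that the shifted matching sum of $B$ with shift $d$ is at most $6k$. Then for every $0 \le i \le n-m$, $A[i,i+m-1]$ matches $B$ if and only if all of the following hold: (1) for each $0 \le j < d$, $A_{i+j}$ matches $B_j$; (2) for each $0 \le j < m-d$ with $\mathbb{S}(A,d)_{i+j} = 1$, $A_{i+j}$ matches $B_j$ and $A_{i+j+d}$ matches $B_{j+d}$; (3) for each $0 \le j < m-d$ with $\mathbb{S}(B,d)_j = 1$, $A_{i+j}$ matches $B_j$ and $A_{i+j+d}$ matches $B_{j+d}$.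
   Context: Strings are indexed from $0$; $X[\alpha,\beta]$ is the substring of $X$ from index $\alpha$ to $\beta$ inclusive. Two characters match if they are equal or at least one of them is the wildcard $\mathsf{?}$; two strings match if they have equal length and match index by index. For a string $X$ of length $\ell$ and a shift $1 \le d < \ell$, the shifted matching array $\mathbb{S}(X,d)$ is the 0/1 array of length $\ell-d$ with $\mathbb{S}(X,d)_i = 0$ if $X_i = X_{i+d}$ and $X_i \ne \mathsf{?}$, and $\mathbb{S}(X,d)_i = 1$ otherwise (i.e. if $X_i=\mathsf{?}$ or $X_{i+d}=\mathsf{?}$ or $X_i\ne X_{i+d}$). The shifted matching sum of $X$ with shift $d$ is $\sum_{i=0}^{\ell-d-1}\mathbb{S}(X,d)_i$. -}

module Defs where

open import Data.Nat using (ℕ; zero; suc; _+_; _∸_; _<_; _≤_)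
open import Data.Nat.Properties using (_<?_; m+n≤o⇒m≤o)
open import Data.Fin using (Fin; fromℕ<; toℕ)
open import Data.Vec using (Vec; lookup)
open import Data.Maybe using (Maybe; just; nothing)
open import Data.List using (List; map; upTo)
open import Data.Nat.ListAction using (sum)
open import Relation.Nullary using (Dec; yes; no; ¬_)
open import Relation.Binary.PropositionalEquality using (_≡_)
open import Relation.Binary.Definitions using (DecidableEquality)
open import Data.Empty using (⊥)
open import Data.Unit using (⊤)

-- Symbols over alphabet Σ: 'nothing' is the wildcard ?, 'just c' a letter.
Sym : Set → Set
Sym Σ = Maybe Σ

CharMatch : {Σ : Set} → Sym Σ → Sym Σ → Set
CharMatch nothing  _        = ⊤
CharMatch (just _) nothing  = ⊤
CharMatch (just a) (just b) = a ≡ b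

wildcards : {Σ : Set} {ℓ : ℕ} → Vec (Sym Σ) ℓ → ℕ
wildcards Data.Vec.[] = 0
wildcards (nothing Data.Vec.∷ xs) = suc (wildcards xs)
wildcards (just _ Data.Vec.∷ xs) = wildcards xs

_!_⟨_⟩ : {A : Set} {ℓ : ℕ} → Vec A ℓ → (i : ℕ) → i < ℓ → A
X ! i ⟨ p ⟩ = lookup X (fromℕ< p)

shiftBit : {Σ : Set} → DecidableEquality Σ → Sym Σ → Sym Σ → ℕ
shiftBit _   nothing  _        = 1
shiftBit _   (just _) nothing  = 1
shiftBit _≟_ (just a) (just b) with a ≟ b
... | yes _ = 0
... | no  _ = 1

𝕊 : {Σ : Set} → DecidableEquality Σ → {ℓ : ℕ} → Vec (Sym Σ) ℓ →
    (d i : ℕ) → i + d < ℓ → ℕ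
𝕊 eq X d i p = shiftBit eq (X ! i ⟨ m+n≤o⇒m≤o (suc i) p ⟩) (X ! i + d ⟨ p ⟩)

shiftSum : {Σ : Set} → DecidableEquality Σ → {ℓ : ℕ} → Vec (Sym Σ) ℓ → ℕ → ℕ
shiftSum eq {ℓ} X d = sum (map term (upTo (ℓ ∸ d)))
  where
  term : ℕ → ℕ
  term i with i + d <? ℓ
  ... | yes p = 𝕊 eq X d i p
  ... | no  _ = 0

SubMatch : {Σ : Set} {n m : ℕ} → Vec (Sym Σ) n → Vec (Sym Σ) m → ℕ → Set
SubMatch {n = n} {m} A B i =
  ∀ j (p : j < m) (q : i + j < n) → CharMatch (A ! i + j ⟨ q ⟩) (B ! j ⟨ p ⟩)

lo : ∀ {i d ℓ : ℕ} → i + d < ℓ → i < ℓ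
lo {i} p = m+n≤o⇒m≤o (suc i) p

-- Only 1 ≤ d matters; the bounds involving k, m ≤ n and i ≤ n ∸ m are what the
-- paper needs for its running time, not for correctness.
-- For sufficiency, argue by induction on j in steps of d: positions j < d are
-- covered by (1); if A_{i+j} matches B_j and both shifted bits at j are 0, then
-- A_{i+j+d} = A_{i+j} and B_{j+d} = B_j are letters, so the match carries over to
-- j + d; if either bit is 1, conditions (2) or (3) supply it directly.
module Submission where

open import Defs
open import Data.Nat using (ℕ; _+_; _∸_; _*_; _<_; _≤_)
open import Data.Nat.Properties using (<-irrelevant; _<?_; ≮⇒≥; m∸n+n≡m; ∸-monoʳ-<; +-assoc)
open import Data.Nat.Induction using (<-rec)
open import Data.Vec using (Vec)
open import Data.Maybe using (just; nothing)
open import Data.Product using (_×_; _,_; proj₂)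
open import Data.Sum using (_⊎_; inj₁; inj₂)
open import Level using (Level)
open import Function.Base using (_∘_)
open import Function.Bundles using (_⇔_; mk⇔)
open import Relation.Nullary using (yes; no)
open import Relation.Binary.PropositionalEquality using (_≡_; refl; sym; cong; subst; subst₂)
open import Relation.Binary.Definitions using (DecidableEquality)

private
  variable
    Σ : Set

!-cong : {X : Set} {ℓ a b : ℕ} (xs : Vec X ℓ) → a ≡ b →
         (p : a < ℓ) (q : b < ℓ) → xs ! a ⟨ p ⟩ ≡ xs ! b ⟨ q ⟩
!-cong xs refl p q = cong (λ r → xs ! _ ⟨ r ⟩) (<-irrelevant p q)

CharMatch-reindexˡ : {n a a′ : ℕ} (A : Vec (Sym Σ) n) {y : Sym Σ} → a ≡ a′ →
                     (p : a < n) (p′ : a′ < n) →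
                     CharMatch (A ! a ⟨ p ⟩) y → CharMatch (A ! a′ ⟨ p′ ⟩) y
CharMatch-reindexˡ A {y} a≡a′ p p′ = subst (λ x → CharMatch x y) (!-cong A a≡a′ p p′)

module _ (_≟_ : DecidableEquality Σ) where

  shiftBit≡0⊎≡1 : (x y : Sym Σ) → shiftBit _≟_ x y ≡ 0 ⊎ shiftBit _≟_ x y ≡ 1
  shiftBit≡0⊎≡1 nothing  y        = inj₂ refl
  shiftBit≡0⊎≡1 (just a) nothing  = inj₂ refl
  shiftBit≡0⊎≡1 (just a) (just b) with a ≟ b
  ... | yes _ = inj₁ refl
  ... | no  _ = inj₂ refl

  shiftBit≡0⇒≡ : (x y : Sym Σ) → shiftBit _≟_ x y ≡ 0 → x ≡ y
  shiftBit≡0⇒≡ (just a) (just b) with a ≟ b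
  ... | yes refl = λ _ → refl
  shiftBit≡0⇒≡ nothing  _        ()
  shiftBit≡0⇒≡ (just a) nothing  ()

  CharMatch-shift : (x y u v : Sym Σ) → CharMatch x u →
                    (shiftBit _≟_ x y ≡ 1 → CharMatch y v) →
                    (shiftBit _≟_ u v ≡ 1 → CharMatch y v) →
                    CharMatch y v
  CharMatch-shift x y u v x≈u xy≡1⇒ uv≡1⇒
    with shiftBit≡0⊎≡1 x y | shiftBit≡0⊎≡1 u v
  ... | inj₂ xy≡1 | _         = xy≡1⇒ xy≡1
  ... | inj₁ _    | inj₂ uv≡1 = uv≡1⇒ uv≡1
  ... | inj₁ xy≡0 | inj₁ uv≡0 =
    subst₂ CharMatch (shiftBit≡0⇒≡ x y xy≡0) (shiftBit≡0⇒≡ u v uv≡0) x≈u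

stride-induction : {ℓ : Level} {d : ℕ} → 1 ≤ d → (P : ℕ → Set ℓ) →
                   (∀ j → j < d → P j) → (∀ j → P j → P (j + d)) → ∀ j → P j
stride-induction {d = d} 1≤d P base step = <-rec P strided
  where
  strided : ∀ j → (∀ {j′} → j′ < j → P j′) → P j
  strided j rec with j <? d
  ... | yes j<d = base j j<d
  ... | no  j≮d = subst P (m∸n+n≡m d≤j) (step (j ∸ d) (rec (∸-monoʳ-< 1≤d d≤j)))
    where d≤j = ≮⇒≥ j≮d

lemma3 : {Σ : Set} (_≟_ : DecidableEquality Σ) (n m : ℕ)
    (A : Vec (Sym Σ) n) (B : Vec (Sym Σ) m) → m ≤ n →
    (k d : ℕ) → k ≡ wildcards A + wildcards B →
    1 ≤ d → d < k → d < m →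
    shiftSum _≟_ B d ≤ 6 * k →
    (i : ℕ) → i ≤ n ∸ m →
    SubMatch A B i ⇔
      (((j : ℕ) → j < d → (p : j < m) (q : i + j < n) →
          CharMatch (A ! i + j ⟨ q ⟩) (B ! j ⟨ p ⟩))
      × ((j : ℕ) (p : j + d < m) (q : (i + j) + d < n) →
          𝕊 _≟_ A d (i + j) q ≡ 1 →
          CharMatch (A ! i + j ⟨ lo q ⟩)
                    (B ! j ⟨ lo p ⟩)
          × CharMatch (A ! (i + j) + d ⟨ q ⟩) (B ! j + d ⟨ p ⟩))
      × ((j : ℕ) (p : j + d < m) (q : (i + j) + d < n) →
          𝕊 _≟_ B d j p ≡ 1 →
          CharMatch (A ! i + j ⟨ lo q ⟩)
                    (B ! j ⟨ lo p ⟩)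
          × CharMatch (A ! (i + j) + d ⟨ q ⟩) (B ! j + d ⟨ p ⟩)))
lemma3 _≟_ n m A B _ _ d _ 1≤d _ _ _ i _ = mk⇔
  (λ match → (λ j _ → match j)
           , (λ j p q _ → match j (lo p) (lo q) , matchShifted match j p q)
           , (λ j p q _ → match j (lo p) (lo q) , matchShifted match j p q))
  (λ (prefix , bitA⇒ , bitB⇒) → stride-induction 1≤d MatchAt prefix
     (λ j matchAt p q → CharMatch-reindexˡ A (+-assoc i j d) (reassoc j q) q
        (CharMatch-shift _≟_ _ _ _ _ (matchAt (lo p) (lo (reassoc j q)))
          (proj₂ ∘ bitA⇒ j p (reassoc j q))
          (proj₂ ∘ bitB⇒ j p (reassoc j q)))))
  where
  MatchAt : ℕ → Set
  MatchAt j = (p : j < m) (q : i + j < n) → CharMatch (A ! i + j ⟨ q ⟩) (B ! j ⟨ p ⟩)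

  reassoc : ∀ j → i + (j + d) < n → (i + j) + d < n
  reassoc j = subst (_< n) (sym (+-assoc i j d))

  matchShifted : SubMatch A B i → ∀ j (p : j + d < m) (q : (i + j) + d < n) →
                 CharMatch (A ! (i + j) + d ⟨ q ⟩) (B ! j + d ⟨ p ⟩)
  matchShifted match j p q =
    CharMatch-reindexˡ A (sym (+-assoc i j d)) q′ q (match (j + d) p q′)
    where q′ = subst (_< n) (+-assoc i j d) q
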